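{- Let $X$ be a finite set, $\alpha:X\to X$ a bijection and $r:X\to X$ a map with $r^2=\mathrm{id}$ and $\alpha^{ -1}=r\alpha r$, and let $E\subseteq X$ be $r$-invariant ($r(E)=E$) such that $(X,\alpha)$ is $E$-bound. Consider the system $(X,[0,L],e,\alpha,r)$. (a) Let $i_{k+1}\to i_k\to\cdots\to i_1\to i_0$ be an $\alpha$-path (i.e. $\alpha(i_{u+1})=i_u$) with $i_0,i_{k+1}\in E$ and $i_u\in X\setminus E$ for $u\in[1,k]$. Then $ri_0\to ri_1\to\cdots\to ri_k\to ri_{k+1}$ is also an $\alpha$-path (i.e. $\alpha(ri_u)=ri_{u+1}$), with $ri_0,ri_{k+1}\in E$ and $ri_u\in X\setminus E$ for $u\in[1,k]$. (b) For such a path and $u\in[1,k]$: $S(ri_u)=S(i_u)$ if and only if $|X_u|=|X_{k-u+1}|$. (c) If $e(\alpha(E))=[0,L]$, then for such a path and $u\in[1,k]$: $S(ri_u)=S(i_u)$ if and only if $u=\frac{k+1}{2}$.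
   Context: $(X,\alpha)$ is $E$-bound if every $\alpha$-cycle meets $E$. The $E$-reaching time is $e(i)=$ the smallest $k\ge0$ with $\alpha^k(i)\in E$, and $L=\max_{i\in X}e(i)$. $X_k=e^{ -1}(k)$ for $k\in[0,L]$. The system $(X,[0,L],e,\alpha,r)$ has macrostates $[0,L]$, micro-to-macro map $e$, and entropy $S(i)=\ln|X_{e(i)}|$. -}

module Defs where

open import Data.Nat using (ℕ; zero; suc; _⊔_; _≟_)
open import Data.Fin using (Fin)
open import Data.Fin.Subset using (Subset; _∈_; _∉_)
open import Data.Fin.Subset.Properties using (_∈?_)
open import Data.Fin.Permutation using (Permutation′; _⟨$⟩ʳ_)
open import Data.List using (List; length; filter; map; foldr; allFin)
open import Data.Product using (∃-syntax; proj₁)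
open import Relation.Binary.PropositionalEquality using (_≡_)
open import Relation.Nullary using (yes; no)

iter : ∀ {A : Set} → (A → A) → ℕ → A → A
iter f zero    x = x
iter f (suc k) x = f (iter f k x)

-- (X, α) is E-bound: every α-cycle meets E, i.e. the α-cycle through
-- each point i (= the orbit {α^k i}) contains a point of E.
EBound : ∀ {n} → Permutation′ n → Subset n → Set
EBound {n} α E = (i : Fin n) → ∃[ k ] (iter (α ⟨$⟩ʳ_) k i ∈ E)

-- first-hit search: least j < fuel with α^j x ∈ E, or fuel if none
search : ∀ {n} → Permutation′ n → Subset n → ℕ → Fin n → ℕ
search α E zero    x = zero
search α E (suc f) x with x ∈? E
... | yes _ = zero
... | no  _ = suc (search α E f (α ⟨$⟩ʳ x))

-- E-reaching time e(i) = least k ≥ 0 with α^k(i) ∈ E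
-- (searched below the witness supplied by E-boundedness, which is a hit).
reach : ∀ {n} (α : Permutation′ n) (E : Subset n) → EBound α E → Fin n → ℕ
reach α E b i = search α E (proj₁ (b i)) i

maxReach : ∀ {n} (α : Permutation′ n) (E : Subset n) → EBound α E → ℕ
maxReach {n} α E b = foldr _⊔_ 0 (map (reach α E b) (allFin n))

cardLevel : ∀ {n} (α : Permutation′ n) (E : Subset n) → EBound α E → ℕ → ℕ
cardLevel {n} α E b m = length (filter (λ i → reach α E b i ≟ m) (allFin n))

-- Ω(i) = |X_{e(i)}|, so that the entropy is S(i) = ln Ω(i)
Ω : ∀ {n} (α : Permutation′ n) (E : Subset n) → EBound α E → Fin n → ℕ
Ω α E b i = cardLevel α E b (reach α E b i)

-- α-path  i_{k+1} → i_k → … → i_0  given as p u = i_u, with i_0, i_{k+1} ∈ E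
-- and i_u ∉ E for u ∈ [1,k]
record IsEPath {n} (α : Permutation′ n) (E : Subset n) (k : ℕ) (p : ℕ → Fin n) : Set where
  field
    step     : ∀ u → u Data.Nat.≤ k → α ⟨$⟩ʳ p (suc u) ≡ p u
    start∈E  : p 0 ∈ E
    end∈E    : p (suc k) ∈ E
    inner∉E  : ∀ u → 1 Data.Nat.≤ u → u Data.Nat.≤ k → p u ∉ E

-- Along an α-path from E to E the reaching time drops by one per step, so
-- e(i_u) = u.  Since r conjugates α to α⁻¹ and preserves E, the points r i_u
-- run along the reversed path, so e(r i_u) = k − u + 1; this gives (a) and (b).
-- For (c), count X_m through the permutation α: |X_m| = #{i : e(α i) = m}.
-- Every i with e(i) = m + 1 lies outside E and has e(α i) = m, and for m ≤ L the
-- hypothesis e(α(E)) = [0, L] adds some x ∈ E ∖ X_{m+1} with e(α x) = m.  Hence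
-- |X_m| strictly decreases on [0, L], and |X_u| = |X_{k−u+1}| forces u = k − u + 1.
module Submission where

open import Defs
open import Data.Nat using (ℕ; zero; suc; _≤_; _<_; _+_; _*_; _∸_; _≟_; z≤n; s≤s)
open import Data.Nat.Properties
open import Data.Fin using (Fin; zero; suc)
open import Data.Fin.Subset using (Subset; _∈_; _∉_)
open import Data.Fin.Subset.Properties using (_∈?_)
open import Data.Fin.Permutation using (Permutation′; _⟨$⟩ʳ_; _⟨$⟩ˡ_; inverseˡ)
open import Data.Vec.Functional using (Vector)
open import Data.List using (length; filter; tabulate; allFin)
open import Data.Bool using (true; false; if_then_else_)
open import Data.Product using (_×_; _,_; proj₁; proj₂; ∃-syntax)
open import Data.Sum using (inj₁; inj₂)
open import Function.Base using (id; _∘_)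
open import Function.Bundles using (_⇔_; mk⇔; Equivalence)
import Function.Properties.Equivalence as ⇔
open import Relation.Nullary using (Dec; yes; no; does; ¬_; contradiction)
open import Relation.Nullary.Decidable using (dec-true; dec-false)
open import Relation.Unary using (Pred; Decidable)
open import Relation.Binary.Definitions using (tri<; tri≈; tri>)
open import Relation.Binary.PropositionalEquality
  using (_≡_; refl; sym; trans; cong; subst; module ≡-Reasoning)
open import Algebra.Properties.CommutativeMonoid.Sum +-0-commutativeMonoid
  using (sum; sum-permute)

indicator : ∀ {p} {P : Set p} → Dec P → ℕ
indicator P? = if does P? then 1 else 0

indicator-mono : ∀ {p q} {P : Set p} {Q : Set q} (P? : Dec P) (Q? : Dec Q) →
                 (P → Q) → indicator P? ≤ indicator Q?
indicator-mono (no  _) _        _   = z≤n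
indicator-mono (yes _) (yes _)  _   = ≤-refl
indicator-mono (yes p) (no ¬q)  P⇒Q = contradiction (P⇒Q p) ¬q

indicator-mono-< : ∀ {p q} {P : Set p} {Q : Set q} (P? : Dec P) (Q? : Dec Q) →
                   ¬ P → Q → indicator P? < indicator Q?
indicator-mono-< P? Q? ¬p q rewrite dec-false P? ¬p | dec-true Q? q = s≤s z≤n

sum-mono-≤ : ∀ {m} {g h : Vector ℕ m} → (∀ i → g i ≤ h i) → sum g ≤ sum h
sum-mono-≤ {zero}  g≤h = z≤n
sum-mono-≤ {suc m} g≤h = +-mono-≤ (g≤h zero) (sum-mono-≤ (g≤h ∘ suc))

sum-mono-< : ∀ {m} {g h : Vector ℕ m} → (∀ i → g i ≤ h i) →
             ∀ x → g x < h x → sum g < sum h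
sum-mono-< g≤h zero    g<h = +-mono-<-≤ g<h (sum-mono-≤ (g≤h ∘ suc))
sum-mono-< g≤h (suc x) g<h = +-mono-≤-< (g≤h zero) (sum-mono-< (g≤h ∘ suc) x g<h)

count : ∀ {n p} {P : Pred (Fin n) p} → Decidable P → ℕ
count {n} P? = length (filter P? (allFin n))

length-filter-tabulate : ∀ {a m p} {A : Set a} {P : Pred A p} (P? : Decidable P) (g : Fin m → A) →
                         length (filter P? (tabulate g)) ≡ sum (λ i → indicator (P? (g i)))
length-filter-tabulate {m = zero}  P? g = refl
length-filter-tabulate {m = suc m} P? g with does (P? (g zero))
... | true  = cong suc (length-filter-tabulate P? (g ∘ suc))
... | false = length-filter-tabulate P? (g ∘ suc)

count-permute : ∀ {n p} {P : Pred (Fin n) p} (P? : Decidable P) (π : Permutation′ n) →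
                count P? ≡ count (P? ∘ (π ⟨$⟩ʳ_))
count-permute P? π = begin
  count P?                                  ≡⟨ length-filter-tabulate P? id ⟩
  sum (λ i → indicator (P? i))              ≡⟨ sum-permute (λ i → indicator (P? i)) π ⟩
  sum (λ i → indicator (P? (π ⟨$⟩ʳ i)))     ≡⟨ length-filter-tabulate (P? ∘ (π ⟨$⟩ʳ_)) id ⟨
  count (P? ∘ (π ⟨$⟩ʳ_))                    ∎
  where open ≡-Reasoning

count-mono-< : ∀ {n p q} {P : Pred (Fin n) p} {Q : Pred (Fin n) q} (P? : Decidable P) (Q? : Decidable Q) →
               (∀ i → P i → Q i) → ∀ x → ¬ P x → Q x → count P? < count Q?
count-mono-< P? Q? P⇒Q x ¬px qx = begin-strict
  count P?                        ≡⟨ length-filter-tabulate P? id ⟩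
  sum (λ i → indicator (P? i))    <⟨ sum-mono-< (λ i → indicator-mono (P? i) (Q? i) (P⇒Q i)) x
                                                (indicator-mono-< (P? x) (Q? x) ¬px qx) ⟩
  sum (λ i → indicator (Q? i))    ≡⟨ length-filter-tabulate Q? id ⟨
  count Q?                        ∎
  where open ≤-Reasoning

+-∸+1 : ∀ {u k} → u ≤ k → u + (k ∸ u + 1) ≡ suc k
+-∸+1 {u} {k} u≤k = begin
  u + (k ∸ u + 1)  ≡⟨ +-assoc u (k ∸ u) 1 ⟨
  u + (k ∸ u) + 1  ≡⟨ cong (_+ 1) (m+[n∸m]≡n u≤k) ⟩
  k + 1            ≡⟨ +-comm k 1 ⟩
  suc k            ∎
  where open ≡-Reasoning

∸+1≤ : ∀ {u k} → 1 ≤ u → u ≤ k → k ∸ u + 1 ≤ k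
∸+1≤ {u} {k} 1≤u u≤k = ≤-pred (≤-trans (+-monoˡ-≤ (k ∸ u + 1) 1≤u) (≤-reflexive (+-∸+1 u≤k)))

≡∸+1⇔double : ∀ {u k} → u ≤ k → (u ≡ k ∸ u + 1) ⇔ (2 * u ≡ k + 1)
≡∸+1⇔double {u} {k} u≤k = mk⇔ to from
  where
  double : 2 * u ≡ u + u
  double = cong (u +_) (+-identityʳ u)
  total : u + (k ∸ u + 1) ≡ k + 1
  total = trans (+-∸+1 u≤k) (+-comm 1 k)
  to : u ≡ k ∸ u + 1 → 2 * u ≡ k + 1
  to u≡d = trans double (trans (cong (u +_) u≡d) total)
  from : 2 * u ≡ k + 1 → u ≡ k ∸ u + 1
  from 2u≡ = +-cancelˡ-≡ u u _ (trans (sym double) (trans 2u≡ (sym total)))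

⇔-≡-swap : ∀ {a a′ c c′ : ℕ} → a ≡ a′ → c ≡ c′ → (a ≡ c) ⇔ (c′ ≡ a′)
⇔-≡-swap refl refl = mk⇔ sym sym

decreasing-on : (f : ℕ → ℕ) (L : ℕ) → (∀ m → m < L → f (suc m) < f m) →
                ∀ {a b} → a < b → b ≤ L → f b < f a
decreasing-on f L f-step {a} {suc b} (s≤s a≤b) b<L with m≤n⇒m<n∨m≡n a≤b
... | inj₁ a<b  = <-trans (f-step b b<L) (decreasing-on f L f-step a<b (<⇒≤ b<L))
... | inj₂ refl = f-step b b<L

injective-on : (f : ℕ → ℕ) (L : ℕ) → (∀ m → m < L → f (suc m) < f m) →
               ∀ {a b} → a ≤ L → b ≤ L → f a ≡ f b → a ≡ b
injective-on f L f-step {a} {b} a≤L b≤L fa≡fb with <-cmp a b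
... | tri< a<b _ _ = contradiction (sym fa≡fb) (<⇒≢ (decreasing-on f L f-step a<b b≤L))
... | tri≈ _ a≡b _ = a≡b
... | tri> _ _ b<a = contradiction fa≡fb (<⇒≢ (decreasing-on f L f-step b<a a≤L))

iter-suc : ∀ {A : Set} (f : A → A) k x → iter f k (f x) ≡ iter f (suc k) x
iter-suc f zero    x = refl
iter-suc f (suc k) x = cong f (iter-suc f k x)

module ReachingTime {n} (α : Permutation′ n) (E : Subset n) where

  FirstHit : ℕ → Fin n → Set
  FirstHit m x = iter (α ⟨$⟩ʳ_) m x ∈ E × (∀ j → j < m → iter (α ⟨$⟩ʳ_) j x ∉ E)

  firstHit-∉ : ∀ {m x} → x ∉ E → FirstHit m (α ⟨$⟩ʳ x) → FirstHit (suc m) x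
  firstHit-∉ {m} {x} x∉E (hit , miss) = subst (_∈ E) (iter-suc _ m x) hit , miss′
    where
    miss′ : ∀ j → j < suc m → iter (α ⟨$⟩ʳ_) j x ∉ E
    miss′ zero    _         = x∉E
    miss′ (suc j) (s≤s j<m) = subst (_∉ E) (iter-suc _ j x) (miss j j<m)

  firstHit-unique : ∀ {m m′ x} → FirstHit m x → FirstHit m′ x → m ≡ m′
  firstHit-unique {m} {m′} (hit , miss) (hit′ , miss′) with <-cmp m m′
  ... | tri< m<m′ _ _ = contradiction hit (miss′ m m<m′)
  ... | tri≈ _ m≡m′ _ = m≡m′
  ... | tri> _ _ m′<m = contradiction hit′ (miss m′ m′<m)

  search-firstHit : ∀ fuel x → iter (α ⟨$⟩ʳ_) fuel x ∈ E → FirstHit (search α E fuel x) x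
  search-firstHit zero       x hit = hit , λ _ ()
  search-firstHit (suc fuel) x hit with x ∈? E
  ... | yes x∈E = x∈E , λ _ ()
  ... | no  x∉E = firstHit-∉ x∉E
    (search-firstHit fuel (α ⟨$⟩ʳ x) (subst (_∈ E) (sym (iter-suc _ fuel x)) hit))

  module _ (b : EBound α E) where

    reach-firstHit : ∀ x → FirstHit (reach α E b x) x
    reach-firstHit x = search-firstHit (proj₁ (b x)) x (proj₂ (b x))

    reach-unique : ∀ {m x} → FirstHit m x → reach α E b x ≡ m
    reach-unique = firstHit-unique (reach-firstHit _)

    reach-∈ : ∀ {x} → x ∈ E → reach α E b x ≡ 0
    reach-∈ x∈E = reach-unique (x∈E , λ _ ())

    reach-∉ : ∀ {x} → x ∉ E → reach α E b x ≡ suc (reach α E b (α ⟨$⟩ʳ x))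
    reach-∉ x∉E = reach-unique (firstHit-∉ x∉E (reach-firstHit _))

    reach-α : ∀ {m x} → reach α E b x ≡ suc m → reach α E b (α ⟨$⟩ʳ x) ≡ m
    reach-α {x = x} ex with x ∈? E
    ... | yes x∈E = contradiction (trans (sym (reach-∈ x∈E)) ex) 0≢1+n
    ... | no  x∉E = suc-injective (trans (sym (reach-∉ x∉E)) ex)

    cardLevel-suc< : ∀ {m} x → x ∈ E → reach α E b (α ⟨$⟩ʳ x) ≡ m →
                     cardLevel α E b (suc m) < cardLevel α E b m
    cardLevel-suc< {m} x x∈E eαx = begin-strict
      count (λ i → reach α E b i ≟ suc m)
        <⟨ count-mono-< _ _ (λ _ → reach-α) x (λ ex → 0≢1+n (trans (sym (reach-∈ x∈E)) ex)) eαx ⟩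
      count (λ i → reach α E b (α ⟨$⟩ʳ i) ≟ m)
        ≡⟨ count-permute (λ i → reach α E b i ≟ m) α ⟨
      count (λ i → reach α E b i ≟ m) ∎
      where open ≤-Reasoning

    cardLevel-injective : (∀ m → m ≤ maxReach α E b → ∃[ x ] (x ∈ E × reach α E b (α ⟨$⟩ʳ x) ≡ m)) →
                          ∀ {m m′} → m ≤ maxReach α E b → m′ ≤ maxReach α E b →
                          cardLevel α E b m ≡ cardLevel α E b m′ → m ≡ m′
    cardLevel-injective hit = injective-on (cardLevel α E b) (maxReach α E b) step
      where
      step : ∀ m → m < maxReach α E b → cardLevel α E b (suc m) < cardLevel α E b m
      step m m<L with x , x∈E , eαx ← hit m (<⇒≤ m<L) = cardLevel-suc< x x∈E eαx

module Reversal {n} (α : Permutation′ n) (r : Fin n → Fin n) (E : Subset n)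
                (r-involutive : ∀ x → r (r x) ≡ x)
                (r-reverses : ∀ x → α ⟨$⟩ˡ x ≡ r (α ⟨$⟩ʳ r x))
                (r-E : ∀ y → (y ∈ E) ⇔ (∃[ x ] (x ∈ E × r x ≡ y))) where

  α-r : ∀ x → α ⟨$⟩ʳ r x ≡ r (α ⟨$⟩ˡ x)
  α-r x = trans (sym (r-involutive _)) (cong r (sym (r-reverses x)))

  r-∈ : ∀ {x} → x ∈ E → r x ∈ E
  r-∈ {x} x∈E = Equivalence.from (r-E (r x)) (x , x∈E , refl)

  r-∈⁻ : ∀ {x} → r x ∈ E → x ∈ E
  r-∈⁻ {x} rx∈E = Equivalence.from (r-E x) (r x , rx∈E , r-involutive x)

  module _ {k : ℕ} {p : ℕ → Fin n} (path : IsEPath α E k p) where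
    open IsEPath path

    reversed-step : ∀ u → u ≤ k → α ⟨$⟩ʳ r (p u) ≡ r (p (suc u))
    reversed-step u u≤k = begin
      α ⟨$⟩ʳ r (p u)                  ≡⟨ α-r (p u) ⟩
      r (α ⟨$⟩ˡ p u)                  ≡⟨ cong (λ y → r (α ⟨$⟩ˡ y)) (step u u≤k) ⟨
      r (α ⟨$⟩ˡ (α ⟨$⟩ʳ p (suc u)))  ≡⟨ cong r (inverseˡ α) ⟩
      r (p (suc u))                   ∎
      where open ≡-Reasoning

    reversed-inner∉E : ∀ u → 1 ≤ u → u ≤ k → r (p u) ∉ E
    reversed-inner∉E u 1≤u u≤k = inner∉E u 1≤u u≤k ∘ r-∈⁻

    module _ (b : EBound α E) where
      open ReachingTime α E

      reach-path : ∀ u → u ≤ k → reach α E b (p u) ≡ u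
      reach-path zero    _     = reach-∈ b start∈E
      reach-path (suc u) u<k = begin
        reach α E b (p (suc u))                  ≡⟨ reach-∉ b (inner∉E (suc u) (s≤s z≤n) u<k) ⟩
        suc (reach α E b (α ⟨$⟩ʳ p (suc u)))     ≡⟨ cong (suc ∘ reach α E b) (step u (<⇒≤ u<k)) ⟩
        suc (reach α E b (p u))                  ≡⟨ cong suc (reach-path u (<⇒≤ u<k)) ⟩
        suc u                                    ∎
        where open ≡-Reasoning

      reach-reversedPath : ∀ u d → 1 ≤ u → u + d ≡ suc k → reach α E b (r (p u)) ≡ d
      reach-reversedPath u zero _ u≡ =
        reach-∈ b (subst (λ v → r (p v) ∈ E) (trans (sym u≡) (+-identityʳ u)) (r-∈ end∈E))
      reach-reversedPath u (suc d) 1≤u u+d≡ = begin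
        reach α E b (r (p u))                  ≡⟨ reach-∉ b (reversed-inner∉E u 1≤u u≤k) ⟩
        suc (reach α E b (α ⟨$⟩ʳ r (p u)))     ≡⟨ cong (suc ∘ reach α E b) (reversed-step u u≤k) ⟩
        suc (reach α E b (r (p (suc u))))      ≡⟨ cong suc (reach-reversedPath (suc u) d (s≤s z≤n)
                                                                 (trans (sym (+-suc u d)) u+d≡)) ⟩
        suc d                                  ∎
        where
        open ≡-Reasoning
        u≤k : u ≤ k
        u≤k = ≤-pred (subst (u <_) u+d≡ (m<m+n u (s≤s z≤n)))

      Ω-reversedPath⇔ : ∀ u → 1 ≤ u → u ≤ k →
        (Ω α E b (r (p u)) ≡ Ω α E b (p u)) ⇔ (cardLevel α E b u ≡ cardLevel α E b (k ∸ u + 1))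
      Ω-reversedPath⇔ u 1≤u u≤k = ⇔-≡-swap
        (cong (cardLevel α E b) (reach-reversedPath u (k ∸ u + 1) 1≤u (+-∸+1 u≤k)))
        (cong (cardLevel α E b) (reach-path u u≤k))

      length≤maxReach : (∀ m → (m ≤ maxReach α E b) ⇔ (∃[ x ] (x ∈ E × reach α E b (α ⟨$⟩ʳ x) ≡ m))) →
                        k ≤ maxReach α E b
      length≤maxReach onto = Equivalence.from (onto k)
        (p (suc k) , end∈E , trans (cong (reach α E b) (step k ≤-refl)) (reach-path k ≤-refl))

theorem30 : (n : ℕ) (α : Permutation′ n) (r : Fin n → Fin n) (E : Subset n) →
    (∀ x → r (r x) ≡ x) →
    (∀ x → α ⟨$⟩ˡ x ≡ r (α ⟨$⟩ʳ r x)) →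
    (∀ y → (y ∈ E) ⇔ (∃[ x ] (x ∈ E × r x ≡ y))) →
    (b : EBound α E) →
    -- (a)
    ((k : ℕ) (p : ℕ → Fin n) → IsEPath α E k p →
      (∀ u → u ≤ k → α ⟨$⟩ʳ r (p u) ≡ r (p (suc u)))
      × r (p 0) ∈ E × r (p (suc k)) ∈ E
      × (∀ u → 1 ≤ u → u ≤ k → r (p u) ∉ E))
    -- (b)
    × ((k : ℕ) (p : ℕ → Fin n) → IsEPath α E k p →
      ∀ u → 1 ≤ u → u ≤ k →
      (Ω α E b (r (p u)) ≡ Ω α E b (p u)) ⇔ (cardLevel α E b u ≡ cardLevel α E b (k ∸ u + 1)))
    -- (c)
    × ((∀ m → (m ≤ maxReach α E b) ⇔ (∃[ x ] (x ∈ E × reach α E b (α ⟨$⟩ʳ x) ≡ m))) →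
      (k : ℕ) (p : ℕ → Fin n) → IsEPath α E k p →
      ∀ u → 1 ≤ u → u ≤ k →
      (Ω α E b (r (p u)) ≡ Ω α E b (p u)) ⇔ (2 * u ≡ k + 1))
theorem30 n α r E r-involutive r-reverses r-E b =
  (λ k p path → reversed-step path , r-∈ (start∈E path) , r-∈ (end∈E path) , reversed-inner∉E path) ,
  (λ k p path → Ω-reversedPath⇔ path b) ,
  λ onto k p path u 1≤u u≤k →
    let k≤L = length≤maxReach path b onto in
    ⇔.trans (Ω-reversedPath⇔ path b u 1≤u u≤k)
      (⇔.trans (mk⇔ (cardLevel-injective b (Equivalence.to ∘ onto) (≤-trans u≤k k≤L)
                                         (≤-trans (∸+1≤ 1≤u u≤k) k≤L))
                    (cong (cardLevel α E b)))
               (≡∸+1⇔double u≤k))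
  where
  open Reversal α r E r-involutive r-reverses r-E
  open ReachingTime α E using (cardLevel-injective)
  open IsEPath
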